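{- For $n\ge2$, the lattice of admissible subalgebras of $K(\mathbf{DP}_n)$ (ordered by inclusion) is a chain if and only if $n\le4$.
   Context: For a bounded commutative residuated lattice $\mathbf A$, $K(\mathbf A)$ is the algebra on $A\times A$ with $(a,b)\vee(c,d)=(a\vee c,b\wedge d)$, $(a,b)\wedge(c,d)=(a\wedge c,b\vee d)$, $(a,b)(c,d)=(ac,(a\to d)\wedge(c\to b))$, $(a,b)\to(c,d)=((a\to c)\wedge(d\to b),ad)$, unit $(1,1)$, constant $0$ as $(0,1)$. A subalgebra $\mathbf S$ of $K(\mathbf A)$ is admissible if the elements of $S$ below $(1,1)$ are exactly all $(a,1)$, $a\in A$. The drastic product chain $\mathbf{DP}_n$ is the $n$-element chain $\{0=a_{n-1}<\dots<a_1<1\}$ with product $xy=0$ if $x,y\ne1$ and $xy=x\wedge y$ otherwise, and its residual implication ($x\to y=1$ if $x\le y$, $=a_1$ if $1>x>y$, $1\to y=y$). -}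

module Defs where

open import Data.Nat using (ℕ; zero; suc; _≤ᵇ_)
open import Data.Fin using (Fin; zero; suc; toℕ; fromℕ)
open import Data.Fin.Properties using (_≟_)
open import Data.Bool using (Bool; true; false; if_then_else_; _∧_; _∨_; not)
open import Data.Product using (_×_; _,_)
open import Relation.Binary.PropositionalEquality using (_≡_)
open import Relation.Nullary.Decidable using (⌊_⌋)
open import Data.Sum using (_⊎_)

-- The drastic product chain DP_n with n = 2 + m elements.
-- The element a_i (0 ≤ i ≤ n-1) is represented by  i : Fin n ;
-- so a_0 = 1 is  zero , a_1 is  suc zero , and a_{n-1} = 0 is  fromℕ (suc m).
-- Order: a_i ≤ a_j  iff  j ≤ i (as naturals).

module DP (m : ℕ) where

  Carrier : Set
  Carrier = Fin (suc (suc m))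

  one : Carrier
  one = zero

  a₁ : Carrier
  a₁ = suc zero

  bot : Carrier
  bot = fromℕ (suc m)

  _≤b_ : Carrier → Carrier → Bool
  x ≤b y = toℕ y ≤ᵇ toℕ x

  _≡b_ : Carrier → Carrier → Bool
  x ≡b y = ⌊ x ≟ y ⌋

  _⊓_ : Carrier → Carrier → Carrier
  x ⊓ y = if x ≤b y then x else y

  _⊔_ : Carrier → Carrier → Carrier
  x ⊔ y = if x ≤b y then y else x

  _·_ : Carrier → Carrier → Carrier
  x · y = if not (x ≡b one) ∧ not (y ≡b one) then bot else x ⊓ y

  _⇒_ : Carrier → Carrier → Carrier
  x ⇒ y = if x ≤b y then one else (if x ≡b one then y else a₁)

  K : Set
  K = Carrier × Carrier

  _∨K_ : K → K → K
  (a , b) ∨K (c , d) = (a ⊔ c , b ⊓ d)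

  _∧K_ : K → K → K
  (a , b) ∧K (c , d) = (a ⊓ c , b ⊔ d)

  _·K_ : K → K → K
  (a , b) ·K (c , d) = (a · c , (a ⇒ d) ⊓ (c ⇒ b))

  _⇒K_ : K → K → K
  (a , b) ⇒K (c , d) = ((a ⇒ c) ⊓ (d ⇒ b) , a · d)

  oneK : K
  oneK = (one , one)

  zeroK : K
  zeroK = (bot , one)

  _≤K_ : K → K → Set
  x ≤K y = (x ∧K y) ≡ x

  SubsetK : Set
  SubsetK = K → Bool

  _∈_ : K → SubsetK → Set
  x ∈ S = S x ≡ true

  _⊆_ : SubsetK → SubsetK → Set
  S ⊆ T = ∀ x → x ∈ S → x ∈ T

  record IsSubalgebra (S : SubsetK) : Set where
    field
      ∨-closed : ∀ x y → x ∈ S → y ∈ S → (x ∨K y) ∈ S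
      ∧-closed : ∀ x y → x ∈ S → y ∈ S → (x ∧K y) ∈ S
      ·-closed : ∀ x y → x ∈ S → y ∈ S → (x ·K y) ∈ S
      ⇒-closed : ∀ x y → x ∈ S → y ∈ S → (x ⇒K y) ∈ S
      one-mem  : oneK ∈ S
      zero-mem : zeroK ∈ S

  record IsAdmissible (S : SubsetK) : Set where
    field
      subalgebra : IsSubalgebra S
      below-one  : ∀ a b → (a , b) ∈ S → (a , b) ≤K oneK → b ≡ one
      all-a1     : ∀ a → ((a , one) ∈ S) × ((a , one) ≤K oneK)

  AdmissibleChain : Set
  AdmissibleChain = ∀ S T → IsAdmissible S → IsAdmissible T → S ⊆ T ⊎ T ⊆ S

-- For n ≤ 4, any two elements x, y of K(DP_n) are comparable in the strong sense that one lies in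
-- the admissible subalgebra generated by the other; then S ⊈ T forces T ⊆ S for admissible S, T.
-- This is decided by computing generated subalgebras. For n ≥ 5, merging a₃, …, a_{n-2} is a
-- monotone map DP_n → DP_5 along which admissible subalgebras of K(DP_5) that do not separate a₁
-- from 1 pull back to admissible subalgebras; two incomparable ones in K(DP_5) settle the case.
module Submission where

open import Defs
open import Data.Nat using (ℕ; suc; _≤_)
open import Data.Nat using (_+_; z≤n; s≤s)
open import Function.Bundles using (_⇔_)

open import Data.Bool using (true; false; if_then_else_; not; _∧_; _∨_)
import Data.Bool.Properties as Bool
open import Data.Empty using (⊥-elim)
open import Data.Fin as F using (Fin; zero; suc; toℕ; fromℕ; pinch; _↑ˡ_)
open import Data.Fin.Properties using (_≟_; all?; ≤-total; ≤-antisym; pinch-mono-≤)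
  renaming (_≤?_ to _≤F?_)
open import Data.List using (List; []; _∷_; _++_; map; concatMap; cartesianProductWith; allFin; deduplicate)
open import Data.List.Relation.Unary.All as All using (All; []; _∷_)
open import Data.List.Relation.Unary.All.Properties
  using (++⁺; concat⁺; map⁺; cartesianProductWith⁺; deduplicate⁺)
import Data.List.Membership.DecPropositional as DecMembership
open import Data.List.Membership.Propositional using () renaming (_∈_ to _∈ₗ_)
import Data.Nat.Properties as ℕ
open import Data.Product using (_,_; proj₁; proj₂)
open import Data.Product.Properties using (≡-dec)
open import Data.Sum using (_⊎_; inj₁; inj₂; [_,_]′)
open import Function using (_∘_; id; case_of_)
open import Function.Bundles using (mk⇔; Equivalence)
open import Relation.Binary.Definitions using (DecidableEquality)
open import Relation.Binary.PropositionalEquality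
open import Relation.Binary.PropositionalEquality.Properties using (setoid)
open import Relation.Nullary using (¬_; Dec; yes; no)
open import Relation.Nullary.Decidable using (map′; _×-dec_; _⊎-dec_; _→-dec_; from-yes; decidable-stable)
open ≡-Reasoning

-- The index order F.≤ on DP.Carrier is the reverse of the lattice order.
module Lattice (m : ℕ) where
  open DP m

  ≤b≡true : ∀ {x y} → y F.≤ x → x ≤b y ≡ true
  ≤b≡true y≤x = Equivalence.to Bool.T-≡ (ℕ.≤⇒≤ᵇ y≤x)

  ≤b≡false : ∀ {x y} → ¬ y F.≤ x → x ≤b y ≡ false
  ≤b≡false {x} {y} y≰x = Bool.¬-not (y≰x ∘ ℕ.≤ᵇ⇒≤ (toℕ y) (toℕ x) ∘ Equivalence.from Bool.T-≡)

  y≤x⇒x⊓y≡x : ∀ {x y} → y F.≤ x → x ⊓ y ≡ x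
  y≤x⇒x⊓y≡x {x} {y} y≤x = cong (λ b → if b then x else y) (≤b≡true y≤x)

  x≤y⇒x⊓y≡y : ∀ {x y} → x F.≤ y → x ⊓ y ≡ y
  x≤y⇒x⊓y≡y {x} {y} x≤y with y ≤F? x
  ... | yes y≤x = trans (y≤x⇒x⊓y≡x y≤x) (≤-antisym x≤y y≤x)
  ... | no y≰x  = cong (λ b → if b then x else y) (≤b≡false y≰x)

  y≤x⇒x⊔y≡y : ∀ {x y} → y F.≤ x → x ⊔ y ≡ y
  y≤x⇒x⊔y≡y {x} {y} y≤x = cong (λ b → if b then y else x) (≤b≡true y≤x)

  x≤y⇒x⊔y≡x : ∀ {x y} → x F.≤ y → x ⊔ y ≡ x
  x≤y⇒x⊔y≡x {x} {y} x≤y with y ≤F? x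
  ... | yes y≤x = trans (y≤x⇒x⊔y≡y y≤x) (≤-antisym y≤x x≤y)
  ... | no y≰x  = cong (λ b → if b then y else x) (≤b≡false y≰x)

  one·y≡y : ∀ y → one · y ≡ y
  one·y≡y zero    = refl
  one·y≡y (suc y) = refl

  x·one≡x : ∀ x → x · one ≡ x
  x·one≡x zero    = refl
  x·one≡x (suc x) = refl

  x·y≡bot : ∀ {x y} → x ≢ one → y ≢ one → x · y ≡ bot
  x·y≡bot {zero}          x≢one _     = ⊥-elim (x≢one refl)
  x·y≡bot {suc x} {zero}  _     y≢one = ⊥-elim (y≢one refl)
  x·y≡bot {suc x} {suc y} _     _     = refl

  y≤x⇒x⇒y≡one : ∀ {x y} → y F.≤ x → x ⇒ y ≡ one
  y≤x⇒x⇒y≡one {x} {y} y≤x =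
    cong (λ b → if b then one else (if x ≡b one then y else a₁)) (≤b≡true y≤x)

  one⇒y≡y : ∀ y → one ⇒ y ≡ y
  one⇒y≡y zero    = refl
  one⇒y≡y (suc y) = refl

  y≰x⇒x⇒y≡a₁ : ∀ {x y} → ¬ y F.≤ x → x ≢ one → x ⇒ y ≡ a₁
  y≰x⇒x⇒y≡a₁ {zero}  _   x≢one = ⊥-elim (x≢one refl)
  y≰x⇒x⇒y≡a₁ {suc x} y≰x _     = cong (λ b → if b then one else a₁) (≤b≡false y≰x)

  squash : Carrier → Carrier
  squash (suc zero) = zero
  squash x          = x

  squash-⊓ : ∀ x y → squash (x ⊓ y) ≡ squash (squash x ⊓ squash y)
  squash-⊓ zero          zero          = refl
  squash-⊓ zero          (suc zero)    = refl
  squash-⊓ zero          (suc (suc y)) = refl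
  squash-⊓ (suc zero)    zero          = refl
  squash-⊓ (suc zero)    (suc zero)    = refl
  squash-⊓ (suc zero)    (suc (suc y)) = refl
  squash-⊓ (suc (suc x)) zero          = refl
  squash-⊓ (suc (suc x)) (suc zero)    = refl
  squash-⊓ (suc (suc x)) (suc (suc y)) = refl

  squashK : K → K
  squashK (a , b) = (squash a , squash b)

module Subalgebras (m : ℕ) where
  open DP m

  Closed : (K → K → K) → SubsetK → Set
  Closed _∙_ S = ∀ x y → x ∈ S → y ∈ S → (x ∙ y) ∈ S

  admissible : ∀ {S} → IsSubalgebra S → (∀ a → (a , one) ∈ S) → IsAdmissible S
  admissible S-sub a1∈S = record
    { subalgebra = S-sub
    ; below-one  = λ _ _ _ ab≤1 → sym (cong proj₂ ab≤1)
    ; all-a1     = λ a → a1∈S a , refl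
    }

  _≟K_ : DecidableEquality K
  _≟K_ = ≡-dec _≟_ _≟_

  ∀K? : ∀ {P : K → Set} → (∀ x → Dec (P x)) → Dec (∀ x → P x)
  ∀K? P? = map′ (λ P-all (a , b) → P-all a b) (λ P-all a b → P-all (a , b))
                (all? λ a → all? λ b → P? (a , b))

  _∈?_ : ∀ x S → Dec (x ∈ S)
  x ∈? S = S x Bool.≟ true

  _⊆?_ : ∀ S T → Dec (S ⊆ T)
  S ⊆? T = ∀K? λ x → (x ∈? S) →-dec (x ∈? T)

  closed? : ∀ _∙_ S → Dec (Closed _∙_ S)
  closed? _∙_ S = ∀K? λ x → ∀K? λ y → (x ∈? S) →-dec (y ∈? S) →-dec ((x ∙ y) ∈? S)

  isSubalgebra? : ∀ S → Dec (IsSubalgebra S)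
  isSubalgebra? S =
    map′ (λ (∨-c , ∧-c , ·-c , ⇒-c , 1∈S , 0∈S) → record
           { ∨-closed = ∨-c ; ∧-closed = ∧-c ; ·-closed = ·-c ; ⇒-closed = ⇒-c
           ; one-mem = 1∈S ; zero-mem = 0∈S })
         (λ S-sub → let open IsSubalgebra S-sub in
           ∨-closed , ∧-closed , ·-closed , ⇒-closed , one-mem , zero-mem)
         (closed? _∨K_ S ×-dec closed? _∧K_ S ×-dec closed? _·K_ S ×-dec closed? _⇒K_ S
           ×-dec oneK ∈? S ×-dec zeroK ∈? S)

  isAdmissible? : ∀ S → Dec (IsAdmissible S)
  isAdmissible? S =
    map′ (λ (S-sub , a1∈S) → admissible S-sub a1∈S)
         (λ S-adm → IsAdmissible.subalgebra S-adm , proj₁ ∘ IsAdmissible.all-a1 S-adm)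
         (isSubalgebra? S ×-dec all? λ a → (a , one) ∈? S)

  operations : List (K → K → K)
  operations = _∨K_ ∷ _∧K_ ∷ _·K_ ∷ _⇒K_ ∷ []

  extend : List K → List K
  extend xs = deduplicate _≟K_ (xs ++ concatMap (λ _∙_ → cartesianProductWith _∙_ xs xs) operations)

  generated : ℕ → K → List K
  generated 0       x = x ∷ map (_, one) (allFin _)
  generated (suc k) x = extend (generated k x)

  generated-⊆ : ∀ {S x} → IsAdmissible S → x ∈ S → ∀ k → All (_∈ S) (generated k x)
  generated-⊆ S-adm x∈S 0       = x∈S ∷ map⁺ (All.tabulate λ {a} _ → proj₁ (all-a1 a))
    where open IsAdmissible S-adm
  generated-⊆ {S} {x} S-adm x∈S (suc k) =
    deduplicate⁺ _≟K_ (++⁺ xs⊆S (concat⁺ (map⁺ (All.map pairs⊆S operations-closed))))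
    where
    open IsSubalgebra (IsAdmissible.subalgebra S-adm)
    xs = generated k x
    xs⊆S = generated-⊆ S-adm x∈S k
    operations-closed : All (λ _∙_ → Closed _∙_ S) operations
    operations-closed = ∨-closed ∷ ∧-closed ∷ ·-closed ∷ ⇒-closed ∷ []
    pairs⊆S : ∀ {_∙_} → Closed _∙_ S → All (_∈ S) (cartesianProductWith _∙_ xs xs)
    pairs⊆S {_∙_} ∙-closed = cartesianProductWith⁺ (setoid K) (setoid K) _∙_ xs xs
      λ x∈ y∈ → ∙-closed _ _ (All.lookup xs⊆S x∈) (All.lookup xs⊆S y∈)

  open DecMembership _≟K_ using () renaming (_∈?_ to _∈ₗ?_)

  Comparable : ℕ → K → K → Set
  Comparable k x y = y ∈ₗ generated k x ⊎ x ∈ₗ generated k y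

  comparable? : ∀ k → Dec (∀ x y → Comparable k x y)
  comparable? k = ∀K? λ x → ∀K? λ y → (y ∈ₗ? generated k x) ⊎-dec (x ∈ₗ? generated k y)

  -- If S ⊈ T then T ⊆ S: comparing some y ∈ T \ S with each x ∈ S would give S ⊆ T.
  chain-if-comparable : ∀ k → (∀ x y → Comparable k x y) → AdmissibleChain
  chain-if-comparable k comparable S T S-adm T-adm with S ⊆? T
  ... | yes S⊆T = inj₁ S⊆T
  ... | no  S⊈T = inj₂ λ y y∈T → decidable-stable (y ∈? S) λ y∉S → S⊈T λ x x∈S →
    case comparable x y of λ
      { (inj₁ y∈⟨x⟩) → ⊥-elim (y∉S (All.lookup (generated-⊆ S-adm x∈S k) y∈⟨x⟩))
      ; (inj₂ x∈⟨y⟩) → All.lookup (generated-⊆ T-adm y∈T k) x∈⟨y⟩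
      }

-- → is preserved only up to identifying a₁ with 1: elements x > y merged by h have x → y = a₁.
module Pullback {m m′ : ℕ} (h : DP.Carrier m → DP.Carrier m′)
  (h-mono : ∀ {x y} → x F.≤ y → h x F.≤ h y)
  (h-one : h zero ≡ zero) (h-one⁻¹ : ∀ {x} → h x ≡ zero → x ≡ zero)
  (h-a₁ : h (suc zero) ≡ suc zero) (h-bot : h (DP.bot m) ≡ DP.bot m′)
  where

  open DP m
  open Lattice m
  open Subalgebras m using (Closed; admissible)
  module B = DP m′
  module BL = Lattice m′
  module BS = Subalgebras m′

  h-⊓ : ∀ x y → h (x ⊓ y) ≡ h x B.⊓ h y
  h-⊓ x y with ≤-total x y
  ... | inj₁ x≤y = trans (cong h (x≤y⇒x⊓y≡y x≤y)) (sym (BL.x≤y⇒x⊓y≡y (h-mono x≤y)))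
  ... | inj₂ y≤x = trans (cong h (y≤x⇒x⊓y≡x y≤x)) (sym (BL.y≤x⇒x⊓y≡x (h-mono y≤x)))

  h-⊔ : ∀ x y → h (x ⊔ y) ≡ h x B.⊔ h y
  h-⊔ x y with ≤-total x y
  ... | inj₁ x≤y = trans (cong h (x≤y⇒x⊔y≡x x≤y)) (sym (BL.x≤y⇒x⊔y≡x (h-mono x≤y)))
  ... | inj₂ y≤x = trans (cong h (y≤x⇒x⊔y≡y y≤x)) (sym (BL.y≤x⇒x⊔y≡y (h-mono y≤x)))

  h-suc≢one : ∀ {x} → h (suc x) ≢ B.one
  h-suc≢one eq with h-one⁻¹ eq
  ... | ()

  h-· : ∀ x y → h (x · y) ≡ h x B.· h y
  h-· zero y = begin
    h (one · y)      ≡⟨ cong h (one·y≡y y) ⟩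
    h y              ≡⟨ sym (BL.one·y≡y (h y)) ⟩
    B.one B.· h y    ≡⟨ cong (B._· h y) (sym h-one) ⟩
    h one B.· h y    ∎
  h-· (suc x) zero = begin
    h (suc x · one)       ≡⟨ cong h (x·one≡x (suc x)) ⟩
    h (suc x)             ≡⟨ sym (BL.x·one≡x (h (suc x))) ⟩
    h (suc x) B.· B.one   ≡⟨ cong (h (suc x) B.·_) (sym h-one) ⟩
    h (suc x) B.· h one   ∎
  h-· (suc x) (suc y) = trans h-bot (sym (BL.x·y≡bot h-suc≢one h-suc≢one))

  h-⇒ : ∀ x y → BL.squash (h (x ⇒ y)) ≡ BL.squash (h x B.⇒ h y)
  h-⇒ x y with y ≤F? x
  ... | yes y≤x = cong BL.squash (begin
    h (x ⇒ y)   ≡⟨ cong h (y≤x⇒x⇒y≡one y≤x) ⟩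
    h one       ≡⟨ h-one ⟩
    B.one       ≡⟨ sym (BL.y≤x⇒x⇒y≡one (h-mono y≤x)) ⟩
    h x B.⇒ h y ∎)
  h-⇒ zero y | no _ = cong BL.squash (begin
    h (one ⇒ y)     ≡⟨ cong h (one⇒y≡y y) ⟩
    h y             ≡⟨ sym (BL.one⇒y≡y (h y)) ⟩
    B.one B.⇒ h y   ≡⟨ cong (B._⇒ h y) (sym h-one) ⟩
    h one B.⇒ h y   ∎)
  h-⇒ (suc x) y | no y≰x with h y ≤F? h (suc x)
  ... | yes hy≤hx = begin
    BL.squash (h (suc x ⇒ y))     ≡⟨ cong (BL.squash ∘ h) (y≰x⇒x⇒y≡a₁ y≰x (λ ())) ⟩
    BL.squash (h a₁)              ≡⟨ cong BL.squash h-a₁ ⟩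
    B.one                         ≡⟨ cong BL.squash (sym (BL.y≤x⇒x⇒y≡one hy≤hx)) ⟩
    BL.squash (h (suc x) B.⇒ h y) ∎
  ... | no hy≰hx = cong BL.squash (begin
    h (suc x ⇒ y)   ≡⟨ cong h (y≰x⇒x⇒y≡a₁ y≰x (λ ())) ⟩
    h a₁            ≡⟨ h-a₁ ⟩
    B.a₁            ≡⟨ sym (BL.y≰x⇒x⇒y≡a₁ hy≰hx h-suc≢one) ⟩
    h (suc x) B.⇒ h y ∎)

  h-⇒⊓⇒ : ∀ a b c d → BL.squash (h ((a ⇒ b) ⊓ (c ⇒ d)))
                    ≡ BL.squash ((h a B.⇒ h b) B.⊓ (h c B.⇒ h d))
  h-⇒⊓⇒ a b c d = begin
    BL.squash (h ((a ⇒ b) ⊓ (c ⇒ d)))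
      ≡⟨ cong BL.squash (h-⊓ (a ⇒ b) (c ⇒ d)) ⟩
    BL.squash (h (a ⇒ b) B.⊓ h (c ⇒ d))
      ≡⟨ BL.squash-⊓ (h (a ⇒ b)) (h (c ⇒ d)) ⟩
    BL.squash (BL.squash (h (a ⇒ b)) B.⊓ BL.squash (h (c ⇒ d)))
      ≡⟨ cong₂ (λ u v → BL.squash (u B.⊓ v)) (h-⇒ a b) (h-⇒ c d) ⟩
    BL.squash (BL.squash (h a B.⇒ h b) B.⊓ BL.squash (h c B.⇒ h d))
      ≡⟨ sym (BL.squash-⊓ (h a B.⇒ h b) (h c B.⇒ h d)) ⟩
    BL.squash ((h a B.⇒ h b) B.⊓ (h c B.⇒ h d)) ∎

  hK : K → B.K
  hK (a , b) = (h a , h b)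

  Commutes : (K → K → K) → (B.K → B.K → B.K) → Set
  Commutes _∙_ _∘′_ = ∀ z w → BL.squashK (hK (z ∙ w)) ≡ BL.squashK (hK z ∘′ hK w)

  hK-∨ : Commutes _∨K_ B._∨K_
  hK-∨ (a , b) (c , d) = cong BL.squashK (cong₂ _,_ (h-⊔ a c) (h-⊓ b d))

  hK-∧ : Commutes _∧K_ B._∧K_
  hK-∧ (a , b) (c , d) = cong BL.squashK (cong₂ _,_ (h-⊓ a c) (h-⊔ b d))

  hK-· : Commutes _·K_ B._·K_
  hK-· (a , b) (c , d) = cong₂ _,_ (cong BL.squash (h-· a c)) (h-⇒⊓⇒ a d c b)

  hK-⇒ : Commutes _⇒K_ B._⇒K_
  hK-⇒ (a , b) (c , d) = cong₂ _,_ (h-⇒⊓⇒ a c d b) (cong BL.squash (h-· a d))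

  module _ (P : B.SubsetK) (P-squash : ∀ u → P (BL.squashK u) ≡ P u) (P-adm : B.IsAdmissible P) where
    open B.IsSubalgebra (B.IsAdmissible.subalgebra P-adm)

    pullback-closed : ∀ {_∙_ _∘′_} → Commutes _∙_ _∘′_ → BS.Closed _∘′_ P → Closed _∙_ (P ∘ hK)
    pullback-closed {_∙_} {_∘′_} commutes ∘′-closed z w z∈ w∈ = begin
      P (hK (z ∙ w))                  ≡⟨ sym (P-squash (hK (z ∙ w))) ⟩
      P (BL.squashK (hK (z ∙ w)))      ≡⟨ cong P (commutes z w) ⟩
      P (BL.squashK (hK z ∘′ hK w))    ≡⟨ P-squash (hK z ∘′ hK w) ⟩
      P (hK z ∘′ hK w)                 ≡⟨ ∘′-closed (hK z) (hK w) z∈ w∈ ⟩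
      true                             ∎

    pullback-admissible : IsAdmissible (P ∘ hK)
    pullback-admissible = admissible
      (record
        { ∨-closed = pullback-closed hK-∨ ∨-closed
        ; ∧-closed = pullback-closed hK-∧ ∧-closed
        ; ·-closed = pullback-closed hK-· ·-closed
        ; ⇒-closed = pullback-closed hK-⇒ ⇒-closed
        ; one-mem  = subst (B._∈ P) (sym (cong₂ _,_ h-one h-one)) one-mem
        ; zero-mem = subst (B._∈ P) (sym (cong₂ _,_ h-bot h-one)) zero-mem
        })
      λ a → subst (λ b → (h a , b) B.∈ P) (sym h-one) (proj₁ (B.IsAdmissible.all-a1 P-adm (h a)))

module DP₅ where
  open DP 3 public
  open Lattice 3 using (squashK)
  open Subalgebras 3 using (isAdmissible?; ∀K?)

  a₂ : Carrier
  a₂ = suc (suc zero)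

  S₅ T₅ : SubsetK
  S₅ (p , q) = a₁ ≤b p ∨ a₁ ≤b q ∨ not (p ≡b bot) ∧ not (q ≡b bot)
  T₅ (p , q) = a₁ ≤b p ∨ a₁ ≤b q ∨ p ≡b a₂ ∨ q ≡b a₂

  S₅-admissible : IsAdmissible S₅
  S₅-admissible = from-yes (isAdmissible? S₅)

  T₅-admissible : IsAdmissible T₅
  T₅-admissible = from-yes (isAdmissible? T₅)

  S₅-squash : ∀ u → S₅ (squashK u) ≡ S₅ u
  S₅-squash = from-yes (∀K? λ u → S₅ (squashK u) Bool.≟ S₅ u)

  T₅-squash : ∀ u → T₅ (squashK u) ≡ T₅ u
  T₅-squash = from-yes (∀K? λ u → T₅ (squashK u) Bool.≟ T₅ u)

pinch-fromℕ : ∀ {n} (i : Fin (suc n)) → pinch i (fromℕ (suc n)) ≡ fromℕ n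
pinch-fromℕ             zero    = refl
pinch-fromℕ {suc n}     (suc i) = cong suc (pinch-fromℕ i)

pinch-suc≡zero : ∀ {n} {i : Fin n} x → pinch (suc i) x ≡ zero → x ≡ zero
pinch-suc≡zero zero    _ = refl
pinch-suc≡zero (suc x) ()

-- Merging a₃, …, a_{n-2} into a single element maps DP_n onto DP_5.
collapse : ∀ k → DP.Carrier (3 + k) → DP.Carrier 3
collapse 0       = id
collapse (suc k) = collapse k ∘ pinch (suc (suc (suc zero)))

collapse-mono : ∀ k {x y} → x F.≤ y → collapse k x F.≤ collapse k y
collapse-mono 0       = id
collapse-mono (suc k) = collapse-mono k ∘ pinch-mono-≤ (suc (suc (suc zero)))

collapse-one⁻¹ : ∀ k {x} → collapse k x ≡ zero → x ≡ zero
collapse-one⁻¹ 0       = id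
collapse-one⁻¹ (suc k) = pinch-suc≡zero _ ∘ collapse-one⁻¹ k

collapse-bot : ∀ k → collapse k (DP.bot (3 + k)) ≡ DP.bot 3
collapse-bot 0       = refl
collapse-bot (suc k) = trans (cong (collapse k) (pinch-fromℕ (suc (suc (suc zero))))) (collapse-bot k)

collapse-fixes : ∀ k (i : Fin 4) → collapse k (i ↑ˡ suc k) ≡ i ↑ˡ 1
collapse-fixes 0       i = refl
collapse-fixes (suc k) i = trans (cong (collapse k) (pinch-↑ˡ i)) (collapse-fixes k i)
  where
  pinch-↑ˡ : ∀ (i : Fin 4) → pinch (suc (suc (suc zero))) (i ↑ˡ suc (suc k)) ≡ i ↑ˡ suc k
  pinch-↑ˡ zero                   = refl
  pinch-↑ˡ (suc zero)             = refl
  pinch-↑ˡ (suc (suc zero))       = refl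
  pinch-↑ˡ (suc (suc (suc zero))) = refl

-- For n ≥ 5 the preimages of S₅ and T₅ are incomparable: (a₃, a₃) lies only in the first and
-- (0, a₂) only in the second.
¬admissibleChain-≥5 : ∀ k → ¬ DP.AdmissibleChain (3 + k)
¬admissibleChain-≥5 k chain = [ S⊈T , T⊈S ]′ (chain S T S-admissible T-admissible)
  where
  open DP (3 + k) using (SubsetK; IsAdmissible; _⊆_; bot)
  open DP₅ using (S₅; T₅; S₅-admissible; T₅-admissible; S₅-squash; T₅-squash)
  open Pullback (collapse k) (collapse-mono k) (collapse-fixes k zero) (collapse-one⁻¹ k)
                (collapse-fixes k (suc zero)) (collapse-bot k)

  S T : SubsetK
  S = S₅ ∘ hK
  T = T₅ ∘ hK

  S-admissible : IsAdmissible S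
  S-admissible = pullback-admissible S₅ S₅-squash S₅-admissible
  T-admissible : IsAdmissible T
  T-admissible = pullback-admissible T₅ T₅-squash T₅-admissible

  separating : ∀ {P Q : DP₅.SubsetK} z {u} → hK z ≡ u → P u ≡ true → Q u ≡ false
             → ¬ (P ∘ hK) ⊆ (Q ∘ hK)
  separating {P} {Q} z {u} hz≡u Pu≡true Qu≡false P⊆Q = case trans (sym Qu≡false) Qu≡true of λ ()
    where
    Qu≡true : Q u ≡ true
    Qu≡true = subst (λ v → Q v ≡ true) hz≡u (P⊆Q z (subst (λ v → P v ≡ true) (sym hz≡u) Pu≡true))

  a₂ a₃ : Fin 4
  a₂ = suc (suc zero)
  a₃ = suc (suc (suc zero))

  S⊈T : ¬ S ⊆ T
  S⊈T = separating {S₅} {T₅} (a₃ ↑ˡ suc k , a₃ ↑ˡ suc k)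
          (cong₂ _,_ (collapse-fixes k a₃) (collapse-fixes k a₃)) refl refl

  T⊈S : ¬ T ⊆ S
  T⊈S = separating {T₅} {S₅} (bot , a₂ ↑ˡ suc k)
          (cong₂ _,_ (collapse-bot k) (collapse-fixes k a₂)) refl refl

admissibleChain-≤4 : ∀ m → suc (suc m) ≤ 4 → DP.AdmissibleChain m
admissibleChain-≤4 0 _ = chain-if-comparable 2 (from-yes (comparable? 2)) where open Subalgebras 0
admissibleChain-≤4 1 _ = chain-if-comparable 2 (from-yes (comparable? 2)) where open Subalgebras 1
admissibleChain-≤4 2 _ = chain-if-comparable 2 (from-yes (comparable? 2)) where open Subalgebras 2
admissibleChain-≤4 (suc (suc (suc k))) (s≤s (s≤s (s≤s (s≤s ()))))

admissibleChain⇒≤4 : ∀ m → DP.AdmissibleChain m → suc (suc m) ≤ 4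
admissibleChain⇒≤4 0                   _     = s≤s (s≤s z≤n)
admissibleChain⇒≤4 1                   _     = s≤s (s≤s (s≤s z≤n))
admissibleChain⇒≤4 2                   _     = s≤s (s≤s (s≤s (s≤s z≤n)))
admissibleChain⇒≤4 (suc (suc (suc k))) chain = ⊥-elim (¬admissibleChain-≥5 k chain)

corollary3p7 : (m : ℕ) → DP.AdmissibleChain m ⇔ suc (suc m) ≤ 4
corollary3p7 m = mk⇔ (admissibleChain⇒≤4 m) (admissibleChain-≤4 m)
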